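{- $\displaystyle \delta(112,121,211, 221, 212, 122) = \delta(112, 122) = \frac{3}{4}$.
   Context: Patterns are words over a totally ordered alphabet; a word $\sigma$ contains an occurrence of a pattern $\pi$ of length $M$ at a set of $M$ positions if the subsequence of $\sigma$ at those positions is order-isomorphic to $\pi$. Packing density: for a word $\sigma\in[k]^n$ and a set $\Pi$ of patterns all of length $M$, let $\nu(\Pi,\sigma)$ be the number of length-$M$ position sets of $\sigma$ at which some pattern of $\Pi$ occurs; $\delta(\Pi,k,n)=\max\{\nu(\Pi,\sigma)/\binom{n}{M} : \sigma\in[k]^n\}$; $\delta(\Pi)=\lim_{n\to\infty}\lim_{k\to\infty}\delta(\Pi,k,n)$. Notation $\delta(\pi_1,\dots,\pi_s)$ means $\delta(\{\pi_1,\dots,\pi_s\})$. -}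

module Defs where

open import Data.Bool using (Bool; true; false; _∧_; _∨_; if_then_else_)
open import Data.Nat as ℕ using (ℕ; zero; suc; _<ᵇ_; _⊔_; _≤_)
open import Data.Nat.Combinatorics using (_C_)
open import Data.Fin using (Fin; toℕ)
open import Data.List using (List; []; _∷_; map; _++_; length; filterᵇ; foldr; concatMap; allFin)
open import Data.Bool.ListAction using (any)
open import Data.Vec using (Vec; lookup)
import Data.Vec as Vec
open import Data.Integer using (+_)
open import Data.Rational using (ℚ; _/_; 0ℚ; _-_; ∣_∣; _<_)
open import Data.Product using (Σ; _×_; ∃)

_==_ : Bool → Bool → Bool
true  == b = b
false == true = false
false == false = true

-- order isomorphism of two words over ℕ (as lists): same length and for all
-- positions i,j:  τ_i < τ_j  iff  π_i < π_j  (this also determines equalities)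
agree : ℕ → ℕ → ℕ → ℕ → Bool
agree a b c d = ((a <ᵇ c) == (b <ᵇ d)) ∧ ((c <ᵇ a) == (d <ᵇ b))

orderIso : List ℕ → List ℕ → Bool
orderIso [] [] = true
orderIso [] (_ ∷ _) = false
orderIso (_ ∷ _) [] = false
orderIso (a ∷ as) (b ∷ bs) = pairs as bs ∧ orderIso as bs
  where
  pairs : List ℕ → List ℕ → Bool
  pairs [] [] = true
  pairs (c ∷ cs) (d ∷ ds) = agree a b c d ∧ pairs cs ds
  pairs _ _ = false

choose : {A : Set} → ℕ → List A → List (List A)
choose zero xs = [] ∷ []
choose (suc m) [] = []
choose (suc m) (x ∷ xs) = map (x ∷_) (choose m xs) ++ choose (suc m) xs

allWords : (k n : ℕ) → List (Vec (Fin k) n)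
allWords k zero = Vec.[] ∷ []
allWords k (suc n) = concatMap (λ a → map (a Vec.∷_) (allWords k n)) (allFin k)

subword : {k n : ℕ} → Vec (Fin k) n → List (Fin n) → List ℕ
subword σ S = map (λ i → toℕ (lookup σ i)) S

ν : (Π : List (List ℕ)) (M : ℕ) {k n : ℕ} → Vec (Fin k) n → ℕ
ν Π M {n = n} σ =
  length (filterᵇ (λ S → any (orderIso (subword σ S)) Π) (choose M (allFin n)))

maxν : (Π : List (List ℕ)) (M k n : ℕ) → ℕ
maxν Π M k n = foldr _⊔_ 0 (map (ν Π M) (allWords k n))

-- δ(Π,k,n) = max ν / C(n,M)   (set to 0 when C(n,M) = 0, i.e. n < M)
δ : (Π : List (List ℕ)) (M k n : ℕ) → ℚ
δ Π M k n with n C M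
... | zero  = 0ℚ
... | suc d = (+ maxν Π M k n) / suc d

ConvergesTo : (ℕ → ℚ) → ℚ → Set
ConvergesTo a L = (ε : ℚ) → 0ℚ < ε → ∃ λ N → (m : ℕ) → N ≤ m → ∣ a m - L ∣ < ε

PackingDensity : (Π : List (List ℕ)) (M : ℕ) → ℚ → Set
PackingDensity Π M L =
  Σ (ℕ → ℚ) λ b → ((n : ℕ) → ConvergesTo (λ k → δ Π M k n) (b n)) × ConvergesTo b L

p112 p121 p211 p221 p212 p122 : List ℕ
p112 = 1 ∷ 1 ∷ 2 ∷ []
p121 = 1 ∷ 2 ∷ 1 ∷ []
p211 = 2 ∷ 1 ∷ 1 ∷ []
p221 = 2 ∷ 2 ∷ 1 ∷ []
p212 = 2 ∷ 1 ∷ 2 ∷ []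
p122 = 1 ∷ 2 ∷ 2 ∷ []

threeQuarters : ℚ
threeQuarters = (+ 3) / 4

{-# OPTIONS --safe #-}

-- A triple of letters matches one of the six patterns iff it takes exactly two distinct
-- values, and every Π between {112, 122} and the six patterns is squeezed as follows.
-- Lower bound: the word 0^a 1^b with a = ⌊n/2⌋, b = ⌈n/2⌉ contains b·C(a,2) + a·C(b,2)
-- ≥ (3/4)·C(n,3) occurrences of 112 or 122.
-- Upper bound: let m_y be the multiplicity in w of the letter at position y.  A two-valued
-- triple {y, y′, z} with w_y = w_y′ ≠ w_z is counted at least twice in Σ_y m_y (n − m_y),
-- and 4 m (n − m) ≤ n², so w has at most n³/8 two-valued triples.
-- Hence 3/4 ≤ δ(Π,k,n) ≤ n³/(8·C(n,3)) → 3/4.  The limit in k is reached at k = n + 1: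
-- replacing every letter by the number of smaller letters in the word keeps all occurrences.
module Submission where

open import Defs
open import Data.Bool using (Bool; true; false; not; _∧_; _∨_; if_then_else_)
open import Data.Bool.ListAction using (any)
open import Data.Bool.Properties using (T-≡)
open import Data.Empty using (⊥-elim)
open import Data.Fin as Fin using (Fin; toℕ)
open import Data.Fin.Properties using (toℕ-fromℕ<; toℕ-inject≤)
import Data.Integer as ℤ
import Data.Integer.Properties as ℤ
import Data.Integer.Tactic.RingSolver as ℤSolver
open import Data.List using (List; []; _∷_; _++_; map; length; filterᵇ; replicate; [_]; foldr; allFin)
open import Data.List.Membership.Propositional using (_∈_)
open import Data.List.Membership.Propositional.Properties using (∈-allFin; ∈-map⁺; ∈-concatMap⁺)
open import Data.List.Properties using (filter-++; length-++; map-∘; map-++; map-tabulate; map-id; map-replicate)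
open import Data.List.Relation.Binary.Subset.Propositional using (_⊆_)
open import Data.List.Relation.Binary.Subset.Propositional.Properties using (Any-resp-⊆; ⊆-refl)
open import Data.List.Relation.Unary.All as All using (All; []; _∷_)
import Data.List.Relation.Unary.All.Properties as All
open import Data.List.Relation.Unary.Any as Any using (here; there)
open import Data.List.Relation.Unary.Any.Properties using (any⁺; any⁻)
open import Data.Nat using (ℕ; zero; suc; ⌊_/2⌋; ⌈_/2⌉; _+_; _*_; _∸_; _⊔_; _<ᵇ_; _≡ᵇ_; _≤_; _<_; z≤n; s≤s)
open import Data.Nat.Combinatorics using (_C_; nCk+nC[k+1]≡[n+1]C[k+1]; nC1≡n)
open import Data.Nat.Coprimality using (Coprime)
open import Data.Nat.ListAction using (sum)
open import Data.Nat.Properties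
open import Data.Nat.Tactic.RingSolver using (solve-∀)
open import Data.Product using (_×_; _,_; proj₁; proj₂; ∃)
open import Data.Rational as ℚ using (ℚ; mkℚ; _/_)
import Data.Rational.Properties as ℚ
open import Data.Rational.Unnormalised as ℚᵘ using (mkℚᵘ)
import Data.Rational.Unnormalised.Properties as ℚᵘ
open import Data.Sum as Sum using (_⊎_; inj₁; inj₂)
open import Data.Vec as Vec using (Vec; lookup)
open import Data.Vec.Properties using (length-toList)
open import Function using (_∘_; id)
open import Function.Bundles using (Equivalence)
open import Relation.Binary.Definitions using (tri<; tri≈; tri>)
open import Relation.Binary.PropositionalEquality
  using (_≡_; _≢_; refl; sym; trans; cong; cong₂; subst; subst₂; module ≡-Reasoning)

private
  variable
    A B : Set

count : (A → Bool) → List A → ℕ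
count p xs = length (filterᵇ p xs)

module _ (p : A → Bool) where

  count-++ : ∀ xs ys → count p (xs ++ ys) ≡ count p xs + count p ys
  count-++ xs ys = trans (cong length (filter-++ _ xs ys)) (length-++ (filterᵇ p xs))

  count≤length : ∀ xs → count p xs ≤ length xs
  count≤length []       = z≤n
  count≤length (x ∷ xs) with p x
  ... | true  = s≤s (count≤length xs)
  ... | false = m≤n⇒m≤1+n (count≤length xs)

  count-replicate-true : ∀ {x} n → p x ≡ true → count p (replicate n x) ≡ n
  count-replicate-true zero    _  = refl
  count-replicate-true (suc n) px rewrite px = cong suc (count-replicate-true n px)

  count-replicate-false : ∀ {x} n → p x ≡ false → count p (replicate n x) ≡ 0
  count-replicate-false zero    _   = refl
  count-replicate-false (suc n) ¬px rewrite ¬px = count-replicate-false n ¬px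

count-map : (p : B → Bool) (f : A → B) (xs : List A) → count p (map f xs) ≡ count (p ∘ f) xs
count-map p f []       = refl
count-map p f (x ∷ xs) with p (f x)
... | true  = cong suc (count-map p f xs)
... | false = count-map p f xs

count-cong : {p q : A → Bool} {xs : List A} → All (λ x → p x ≡ q x) xs → count p xs ≡ count q xs
count-cong         []                 = refl
count-cong {q = q} {x ∷ _} (px≡qx ∷ eqs) rewrite px≡qx with q x
... | true  = cong suc (count-cong eqs)
... | false = count-cong eqs

count-mono : {p q : A → Bool} → (∀ x → p x ≡ true → q x ≡ true) → ∀ xs → count p xs ≤ count q xs
count-mono                 p⇒q []       = z≤n
count-mono {p = p} {q} p⇒q (x ∷ xs) with p x | q x | p⇒q x
... | true  | true  | _    = s≤s (count-mono p⇒q xs)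
... | true  | false | p⇒qx with () ← p⇒qx refl
... | false | true  | _    = m≤n⇒m≤1+n (count-mono p⇒q xs)
... | false | false | _    = count-mono p⇒q xs

count-mono-< : {p q : A → Bool} → (∀ x → p x ≡ true → q x ≡ true) →
               ∀ {x xs} → x ∈ xs → p x ≡ false → q x ≡ true → count p xs < count q xs
count-mono-< p⇒q {xs = x ∷ xs} (here refl) ¬px qx rewrite ¬px | qx = s≤s (count-mono p⇒q xs)
count-mono-< {p = p} {q} p⇒q {xs = y ∷ xs} (there x∈xs) ¬px qx with p y | q y | p⇒q y
... | true  | true  | _    = s≤s (count-mono-< p⇒q x∈xs ¬px qx)
... | true  | false | p⇒qy with () ← p⇒qy refl
... | false | true  | _    = m≤n⇒m≤1+n (count-mono-< p⇒q x∈xs ¬px qx)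
... | false | false | _    = count-mono-< p⇒q x∈xs ¬px qx

count-∨ : (p q : A → Bool) (xs : List A) → count (λ x → p x ∨ q x) xs ≤ count p xs + count q xs
count-∨ p q []       = z≤n
count-∨ p q (x ∷ xs) with p x | q x
... | true  | true  = s≤s (≤-trans (count-∨ p q xs) (≤-trans (n≤1+n _) (≤-reflexive (sym (+-suc _ _)))))
... | true  | false = s≤s (count-∨ p q xs)
... | false | true  = ≤-trans (s≤s (count-∨ p q xs)) (≤-reflexive (sym (+-suc _ _)))
... | false | false = count-∨ p q xs

choose-map : (f : A → B) (m : ℕ) (xs : List A) → choose m (map f xs) ≡ map (map f) (choose m xs)
choose-map f zero    xs       = refl
choose-map f (suc m) []       = refl
choose-map f (suc m) (x ∷ xs) = begin
  map (f x ∷_) (choose m (map f xs)) ++ choose (suc m) (map f xs)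
    ≡⟨ cong₂ (λ ys zs → map (f x ∷_) ys ++ zs) (choose-map f m xs) (choose-map f (suc m) xs) ⟩
  map (f x ∷_) (map (map f) (choose m xs)) ++ map (map f) (choose (suc m) xs)
    ≡⟨ cong (_++ _) (trans (sym (map-∘ (choose m xs))) (map-∘ (choose m xs))) ⟩
  map (map f) (map (x ∷_) (choose m xs)) ++ map (map f) (choose (suc m) xs)
    ≡⟨ map-++ (map f) (map (x ∷_) (choose m xs)) (choose (suc m) xs) ⟨
  map (map f) (map (x ∷_) (choose m xs) ++ choose (suc m) xs) ∎
  where open ≡-Reasoning

choose⁺ : {P : A → Set} (m : ℕ) {xs : List A} → All P xs → All (λ t → All P t × length t ≡ m) (choose m xs)
choose⁺ zero    _          = ([] , refl) ∷ []
choose⁺ (suc m) []         = []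
choose⁺ (suc m) (px ∷ pxs) =
  All.++⁺ (All.map⁺ (All.map (λ (pt , len) → px ∷ pt , cong suc len) (choose⁺ m pxs))) (choose⁺ (suc m) pxs)

count-choose-∷ : (p : List A → Bool) (m : ℕ) (x : A) (xs : List A) →
                 count p (choose (suc m) (x ∷ xs)) ≡ count (p ∘ (x ∷_)) (choose m xs) + count p (choose (suc m) xs)
count-choose-∷ p m x xs = trans (count-++ p (map (x ∷_) (choose m xs)) _)
                                (cong (_+ _) (count-map p (x ∷_) (choose m xs)))

choose-1 : (xs : List A) → choose 1 xs ≡ map [_] xs
choose-1 []       = refl
choose-1 (x ∷ xs) = cong ([ x ] ∷_) (choose-1 xs)

count-choose-2-∷ : (p : List A → Bool) (y : A) (ys : List A) →
                   count p (choose 2 (y ∷ ys)) ≡ count (λ z → p (y ∷ z ∷ [])) ys + count p (choose 2 ys)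
count-choose-2-∷ p y ys = trans (count-choose-∷ p 1 y ys)
  (cong (_+ _) (trans (cong (count (p ∘ (y ∷_))) (choose-1 ys)) (count-map (p ∘ (y ∷_)) [_] ys)))

replicate-+ : ∀ m n (x : A) → replicate (m + n) x ≡ replicate m x ++ replicate n x
replicate-+ zero    n x = refl
replicate-+ (suc m) n x = cong (x ∷_) (replicate-+ m n x)

choose-replicate : ∀ m n (x : A) → choose m (replicate n x) ≡ replicate (n C m) (replicate m x)
choose-replicate zero    n       x = refl
choose-replicate (suc m) zero    x = refl
choose-replicate (suc m) (suc n) x = begin
  map (x ∷_) (choose m (replicate n x)) ++ choose (suc m) (replicate n x)
    ≡⟨ cong₂ (λ s t → map (x ∷_) s ++ t) (choose-replicate m n x) (choose-replicate (suc m) n x) ⟩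
  map (x ∷_) (replicate (n C m) (replicate m x)) ++ replicate (n C suc m) (replicate (suc m) x)
    ≡⟨ cong (_++ replicate (n C suc m) (replicate (suc m) x)) (map-replicate (x ∷_) (n C m) (replicate m x)) ⟩
  replicate (n C m) (replicate (suc m) x) ++ replicate (n C suc m) (replicate (suc m) x)
    ≡⟨ replicate-+ (n C m) (n C suc m) (replicate (suc m) x) ⟨
  replicate (n C m + n C suc m) (replicate (suc m) x)
    ≡⟨ cong (λ k → replicate k (replicate (suc m) x)) (nCk+nC[k+1]≡[n+1]C[k+1] n m) ⟩
  replicate (suc n C suc m) (replicate (suc m) x) ∎
  where open ≡-Reasoning

matches : List (List ℕ) → List ℕ → Bool
matches Π t = any (orderIso t) Π

occurrences : List (List ℕ) → ℕ → List ℕ → ℕ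
occurrences Π M w = count (matches Π) (choose M w)

matches-mono : {Π Π′ : List (List ℕ)} → Π ⊆ Π′ → ∀ t → matches Π t ≡ true → matches Π′ t ≡ true
matches-mono Π⊆Π′ t m =
  Equivalence.to T-≡ (any⁺ (orderIso t) (Any-resp-⊆ Π⊆Π′ (any⁻ (orderIso t) _ (Equivalence.from T-≡ m))))

occurrences-mono : {Π Π′ : List (List ℕ)} → Π ⊆ Π′ → ∀ M w → occurrences Π M w ≤ occurrences Π′ M w
occurrences-mono Π⊆Π′ M w = count-mono (matches-mono Π⊆Π′) (choose M w)

letters : {k n : ℕ} → Vec (Fin k) n → List ℕ
letters σ = Vec.toList (Vec.map toℕ σ)

length-letters : {k n : ℕ} (σ : Vec (Fin k) n) → length (letters σ) ≡ n
length-letters σ = length-toList (Vec.map toℕ σ)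

letters-allFin : {k n : ℕ} (σ : Vec (Fin k) n) → map (λ i → toℕ (lookup σ i)) (allFin n) ≡ letters σ
letters-allFin Vec.[]       = refl
letters-allFin (a Vec.∷ σ) = cong (toℕ a ∷_)
  (trans (map-tabulate Fin.suc _) (trans (sym (map-tabulate id _)) (letters-allFin σ)))

ν≡occurrences : (Π : List (List ℕ)) (M : ℕ) {k n : ℕ} (σ : Vec (Fin k) n) → ν Π M σ ≡ occurrences Π M (letters σ)
ν≡occurrences Π M {n = n} σ = begin
  count (matches Π ∘ map letter) (choose M (allFin n))
    ≡⟨ count-map (matches Π) (map letter) (choose M (allFin n)) ⟨
  count (matches Π) (map (map letter) (choose M (allFin n)))
    ≡⟨ cong (count (matches Π)) (choose-map letter M (allFin n)) ⟨
  occurrences Π M (map letter (allFin n))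
    ≡⟨ cong (occurrences Π M) (letters-allFin σ) ⟩
  occurrences Π M (letters σ) ∎
  where
  open ≡-Reasoning
  letter : Fin n → ℕ
  letter i = toℕ (lookup σ i)

∈-allWords : {k n : ℕ} (σ : Vec (Fin k) n) → σ ∈ allWords k n
∈-allWords {k} Vec.[]      = here refl
∈-allWords {k} (a Vec.∷ σ) =
  ∈-concatMap⁺ (λ b → map (b Vec.∷_) (allWords k _))
               (Any.map (λ { refl → ∈-map⁺ (a Vec.∷_) (∈-allWords σ) }) (∈-allFin a))

module _ {C : Set} (g : C → ℕ) where

  ∈⇒≤-foldr-⊔ : ∀ {x} xs → x ∈ xs → g x ≤ foldr _⊔_ 0 (map g xs)
  ∈⇒≤-foldr-⊔ (y ∷ xs) (here refl) = m≤m⊔n (g y) _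
  ∈⇒≤-foldr-⊔ (y ∷ xs) (there x∈xs) = ≤-trans (∈⇒≤-foldr-⊔ xs x∈xs) (m≤n⊔m (g y) _)

  foldr-⊔-lub : ∀ {b} xs → (∀ x → g x ≤ b) → foldr _⊔_ 0 (map g xs) ≤ b
  foldr-⊔-lub []       _ = z≤n
  foldr-⊔-lub (y ∷ xs) h = ⊔-lub (h y) (foldr-⊔-lub xs h)

  *-distribˡ-foldr-⊔ : ∀ c xs → c * foldr _⊔_ 0 (map g xs) ≡ foldr _⊔_ 0 (map ((c *_) ∘ g) xs)
  *-distribˡ-foldr-⊔ c []       = *-zeroʳ c
  *-distribˡ-foldr-⊔ c (y ∷ xs) = trans (*-distribˡ-⊔ c (g y) _) (cong (c * g y ⊔_) (*-distribˡ-foldr-⊔ c xs))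

ν≤maxν : (Π : List (List ℕ)) (M : ℕ) {k n : ℕ} (σ : Vec (Fin k) n) → ν Π M σ ≤ maxν Π M k n
ν≤maxν Π M σ = ∈⇒≤-foldr-⊔ (ν Π M) _ (∈-allWords σ)

*-maxν-lub : (Π : List (List ℕ)) (M c : ℕ) {k n b : ℕ} → (∀ (σ : Vec (Fin k) n) → c * ν Π M σ ≤ b) →
             c * maxν Π M k n ≤ b
*-maxν-lub Π M c {k} {n} h =
  subst (_≤ _) (sym (*-distribˡ-foldr-⊔ (ν Π M) c (allWords k n))) (foldr-⊔-lub ((c *_) ∘ ν Π M) (allWords k n) h)

maxν-lub : (Π : List (List ℕ)) (M : ℕ) {k n b : ℕ} → (∀ (σ : Vec (Fin k) n) → ν Π M σ ≤ b) → maxν Π M k n ≤ b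
maxν-lub Π M {k} {n} = foldr-⊔-lub (ν Π M) (allWords k n)

-- Independence of the alphabet size
<ᵇ-true : ∀ {m n} → m < n → (m <ᵇ n) ≡ true
<ᵇ-true (s≤s z≤n)       = refl
<ᵇ-true (s≤s (s≤s m<n)) = <ᵇ-true (s≤s m<n)

<ᵇ-false : ∀ {m n} → n ≤ m → (m <ᵇ n) ≡ false
<ᵇ-false z≤n       = refl
<ᵇ-false (s≤s n≤m) = <ᵇ-false n≤m

<ᵇ-sound : ∀ m n → (m <ᵇ n) ≡ true → m < n
<ᵇ-sound zero    (suc n) _ = s≤s z≤n
<ᵇ-sound (suc m) (suc n) e = s≤s (<ᵇ-sound m n e)

SameOrder : ℕ → ℕ → ℕ → ℕ → Set
SameOrder a b a′ b′ = (a <ᵇ b) ≡ (a′ <ᵇ b′) × (b <ᵇ a) ≡ (b′ <ᵇ a′)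

module _ {a b c a′ b′ c′ : ℕ} (ab : SameOrder a b a′ b′) (ac : SameOrder a c a′ c′) (bc : SameOrder b c b′ c′) where

  orderIso₃-cong : ∀ p → orderIso (a ∷ b ∷ c ∷ []) p ≡ orderIso (a′ ∷ b′ ∷ c′ ∷ []) p
  orderIso₃-cong []                      = refl
  orderIso₃-cong (_ ∷ [])                = refl
  orderIso₃-cong (_ ∷ _ ∷ [])            rewrite proj₁ ab | proj₂ ab = refl
  orderIso₃-cong (_ ∷ _ ∷ _ ∷ [])
    rewrite proj₁ ab | proj₂ ab | proj₁ ac | proj₂ ac | proj₁ bc | proj₂ bc = refl
  orderIso₃-cong (_ ∷ _ ∷ _ ∷ _ ∷ _)
    rewrite proj₁ ab | proj₂ ab | proj₁ ac | proj₂ ac | proj₁ bc | proj₂ bc = refl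

  matches₃-cong : ∀ Π → matches Π (a ∷ b ∷ c ∷ []) ≡ matches Π (a′ ∷ b′ ∷ c′ ∷ [])
  matches₃-cong []      = refl
  matches₃-cong (p ∷ Π) = cong₂ _∨_ (orderIso₃-cong p) (matches₃-cong Π)

OrderPreservingOn : List ℕ → (ℕ → ℕ) → Set
OrderPreservingOn w f = ∀ {x y} → x ∈ w → y ∈ w → (x <ᵇ y) ≡ (f x <ᵇ f y)

occurrences₃-relabel : (Π : List (List ℕ)) (w : List ℕ) (f : ℕ → ℕ) → OrderPreservingOn w f →
                       occurrences Π 3 (map f w) ≡ occurrences Π 3 w
occurrences₃-relabel Π w f f-mono = begin
  count (matches Π) (choose 3 (map f w))       ≡⟨ cong (count (matches Π)) (choose-map f 3 w) ⟩
  count (matches Π) (map (map f) (choose 3 w)) ≡⟨ count-map (matches Π) (map f) (choose 3 w) ⟩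
  count (matches Π ∘ map f) (choose 3 w)       ≡⟨ count-cong (All.map relabel (choose⁺ 3 (All.tabulate id))) ⟩
  count (matches Π) (choose 3 w)               ∎
  where
  open ≡-Reasoning
  relabel : ∀ {t} → All (_∈ w) t × length t ≡ 3 → matches Π (map f t) ≡ matches Π t
  relabel {a ∷ b ∷ c ∷ []} (a∈ ∷ b∈ ∷ c∈ ∷ [] , refl) = sym (matches₃-cong
    (f-mono a∈ b∈ , f-mono b∈ a∈) (f-mono a∈ c∈ , f-mono c∈ a∈) (f-mono b∈ c∈ , f-mono c∈ b∈) Π)

rank : List ℕ → ℕ → ℕ
rank w v = count (_<ᵇ v) w

rank-< : (w : List ℕ) {x y : ℕ} → x ∈ w → x < y → rank w x < rank w y
rank-< w {x} {y} x∈w x<y =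
  count-mono-< (λ z z<x → <ᵇ-true (<-trans (<ᵇ-sound z x z<x) x<y)) x∈w (<ᵇ-false (≤-refl {x})) (<ᵇ-true x<y)

rank-orderPreserving : (w : List ℕ) → OrderPreservingOn w (rank w)
rank-orderPreserving w {x} {y} x∈w y∈w with <-cmp x y
... | tri< x<y _ _ = trans (<ᵇ-true x<y) (sym (<ᵇ-true (rank-< w x∈w x<y)))
... | tri≈ _ refl _ = trans (<ᵇ-false (≤-refl {x})) (sym (<ᵇ-false (≤-refl {rank w x})))
... | tri> _ _ y<x = trans (<ᵇ-false (<⇒≤ y<x)) (sym (<ᵇ-false (<⇒≤ (rank-< w y∈w y<x))))

letters-map : {k k′ n : ℕ} (g : Fin k → Fin k′) (h : ℕ → ℕ) → (∀ a → toℕ (g a) ≡ h (toℕ a)) →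
              (σ : Vec (Fin k) n) → letters (Vec.map g σ) ≡ map h (letters σ)
letters-map g h gh Vec.[]      = refl
letters-map g h gh (a Vec.∷ σ) = cong₂ _∷_ (gh a) (letters-map g h gh σ)

rank-letters≤ : {k n : ℕ} (σ : Vec (Fin k) n) (v : ℕ) → rank (letters σ) v ≤ n
rank-letters≤ σ v = subst (rank (letters σ) v ≤_) (length-letters σ) (count≤length _ (letters σ))

-- Ranks are bounded by the length n without any membership argument, hence the alphabet Fin (suc n).
compress : {k n : ℕ} → Vec (Fin k) n → Vec (Fin (suc n)) n
compress σ = Vec.map (λ a → Fin.fromℕ< (s≤s (rank-letters≤ σ (toℕ a)))) σ

ν-compress : (Π : List (List ℕ)) {k n : ℕ} (σ : Vec (Fin k) n) → ν Π 3 (compress σ) ≡ ν Π 3 σ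
ν-compress Π σ = begin
  ν Π 3 (compress σ)                                       ≡⟨ ν≡occurrences Π 3 (compress σ) ⟩
  occurrences Π 3 (letters (compress σ))
    ≡⟨ cong (occurrences Π 3) (letters-map _ (rank (letters σ)) (λ _ → toℕ-fromℕ< _) σ) ⟩
  occurrences Π 3 (map (rank (letters σ)) (letters σ))
    ≡⟨ occurrences₃-relabel Π (letters σ) _ (rank-orderPreserving (letters σ)) ⟩
  occurrences Π 3 (letters σ)                              ≡⟨ ν≡occurrences Π 3 σ ⟨
  ν Π 3 σ                                                  ∎
  where open ≡-Reasoning

embed : {k k′ n : ℕ} → k ≤ k′ → Vec (Fin k) n → Vec (Fin k′) n
embed k≤k′ = Vec.map (λ a → Fin.inject≤ a k≤k′)

ν-embed : (Π : List (List ℕ)) (M : ℕ) {k k′ n : ℕ} (k≤k′ : k ≤ k′) (σ : Vec (Fin k) n) →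
          ν Π M (embed k≤k′ σ) ≡ ν Π M σ
ν-embed Π M k≤k′ σ = begin
  ν Π M (embed k≤k′ σ)                        ≡⟨ ν≡occurrences Π M (embed k≤k′ σ) ⟩
  occurrences Π M (letters (embed k≤k′ σ))
    ≡⟨ cong (occurrences Π M) (letters-map _ id (λ a → toℕ-inject≤ a k≤k′) σ) ⟩
  occurrences Π M (map id (letters σ))        ≡⟨ cong (occurrences Π M) (map-id (letters σ)) ⟩
  occurrences Π M (letters σ)                 ≡⟨ ν≡occurrences Π M σ ⟨
  ν Π M σ                                     ∎
  where open ≡-Reasoning

maxν-saturates : (Π : List (List ℕ)) {k n : ℕ} → suc n ≤ k → maxν Π 3 k n ≡ maxν Π 3 (suc n) n
maxν-saturates Π {k} {n} n<k = ≤-antisym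
  (maxν-lub Π 3 {k} {n} λ σ → subst (_≤ maxν Π 3 (suc n) n) (ν-compress Π σ) (ν≤maxν Π 3 (compress σ)))
  (maxν-lub Π 3 {suc n} {n} λ σ → subst (_≤ maxν Π 3 k n) (ν-embed Π 3 n<k σ) (ν≤maxν Π 3 (embed n<k σ)))

δ-cong : (Π : List (List ℕ)) (M : ℕ) {k k′ n : ℕ} → maxν Π M k n ≡ maxν Π M k′ n → δ Π M k n ≡ δ Π M k′ n
δ-cong Π M {n = n} eq with n C M
... | zero  = refl
... | suc d = cong (λ x → (ℤ.+ x) / suc d) eq

eventually-constant⇒convergesTo : (a : ℕ → ℚ) (L : ℚ) (N : ℕ) → (∀ m → N ≤ m → a m ≡ L) → ConvergesTo a L
eventually-constant⇒convergesTo a L N aₘ≡L ε 0<ε = N , λ m N≤m →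
  subst (λ x → ℚ.∣ x ℚ.- L ∣ ℚ.< ε) (sym (aₘ≡L m N≤m))
        (subst (λ x → ℚ.∣ x ∣ ℚ.< ε) (sym (ℚ.+-inverseʳ L)) 0<ε)

δ-convergesTo-in-k : (Π : List (List ℕ)) (n : ℕ) → ConvergesTo (λ k → δ Π 3 k n) (δ Π 3 (suc n) n)
δ-convergesTo-in-k Π n = eventually-constant⇒convergesTo (λ k → δ Π 3 k n) (δ Π 3 (suc n) n) (suc n)
  λ k n<k → δ-cong Π 3 {k} {suc n} {n} (maxν-saturates Π n<k)

twoLetterPatterns risingTwoLetterPatterns : List (List ℕ)
twoLetterPatterns       = p112 ∷ p121 ∷ p211 ∷ p221 ∷ p212 ∷ p122 ∷ []
risingTwoLetterPatterns = p112 ∷ p122 ∷ []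

twoLetter : List ℕ → Bool
twoLetter = matches twoLetterPatterns

rising⊆twoLetter : risingTwoLetterPatterns ⊆ twoLetterPatterns
rising⊆twoLetter (here refl)         = here refl
rising⊆twoLetter (there (here refl)) = there (there (there (there (there (here refl)))))

ordered : ∀ {a b} → a < b → (a <ᵇ b) ≡ true × (b <ᵇ a) ≡ false
ordered a<b = <ᵇ-true a<b , <ᵇ-false (<⇒≤ a<b)

reversed : ∀ {a b} → b < a → (a <ᵇ b) ≡ false × (b <ᵇ a) ≡ true
reversed b<a = <ᵇ-false (<⇒≤ b<a) , <ᵇ-true b<a

tied : ∀ a → (a <ᵇ a) ≡ false × (a <ᵇ a) ≡ false
tied a = <ᵇ-false (≤-refl {a}) , <ᵇ-false (≤-refl {a})

module _ {x y z : ℕ} where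

  private
    relabel : ∀ a b c → SameOrder x y a b → SameOrder x z a c → SameOrder y z b c →
              twoLetter (x ∷ y ∷ z ∷ []) ≡ twoLetter (a ∷ b ∷ c ∷ [])
    relabel a b c xy xz yz = matches₃-cong {x} {y} {z} {a} {b} {c} xy xz yz twoLetterPatterns

  twoLetter-constant : x ≡ y → y ≡ z → twoLetter (x ∷ y ∷ z ∷ []) ≡ false
  twoLetter-constant refl refl = relabel 0 0 0 (tied x) (tied x) (tied x)

  -- Distinct letters are order-isomorphic to a permutation of 0 1 2, which matches no two-letter pattern.
  twoLetter-distinct : x ≢ y → y ≢ z → x ≢ z → twoLetter (x ∷ y ∷ z ∷ []) ≡ false
  twoLetter-distinct x≢y y≢z x≢z with <-cmp x y | <-cmp y z | <-cmp x z
  ... | tri≈ _ x≡y _ | _            | _            = ⊥-elim (x≢y x≡y)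
  ... | _            | tri≈ _ y≡z _ | _            = ⊥-elim (y≢z y≡z)
  ... | _            | _            | tri≈ _ x≡z _ = ⊥-elim (x≢z x≡z)
  ... | tri< x<y _ _ | tri< y<z _ _ | tri< x<z _ _ = relabel 0 1 2 (ordered x<y)  (ordered x<z)  (ordered y<z)
  ... | tri< x<y _ _ | tri< y<z _ _ | tri> _ _ z<x = ⊥-elim (<-asym (<-trans x<y y<z) z<x)
  ... | tri< x<y _ _ | tri> _ _ z<y | tri< x<z _ _ = relabel 0 2 1 (ordered x<y)  (ordered x<z)  (reversed z<y)
  ... | tri< x<y _ _ | tri> _ _ z<y | tri> _ _ z<x = relabel 1 2 0 (ordered x<y)  (reversed z<x) (reversed z<y)
  ... | tri> _ _ y<x | tri< y<z _ _ | tri< x<z _ _ = relabel 1 0 2 (reversed y<x) (ordered x<z)  (ordered y<z)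
  ... | tri> _ _ y<x | tri< y<z _ _ | tri> _ _ z<x = relabel 2 0 1 (reversed y<x) (reversed z<x) (ordered y<z)
  ... | tri> _ _ y<x | tri> _ _ z<y | tri< x<z _ _ = ⊥-elim (<-asym (<-trans z<y y<x) x<z)
  ... | tri> _ _ y<x | tri> _ _ z<y | tri> _ _ z<x = relabel 2 1 0 (reversed y<x) (reversed z<x) (reversed z<y)

-- Upper bound
≡ᵇ-refl : ∀ n → (n ≡ᵇ n) ≡ true
≡ᵇ-refl zero    = refl
≡ᵇ-refl (suc n) = ≡ᵇ-refl n

≡ᵇ-sym : ∀ m n → (m ≡ᵇ n) ≡ (n ≡ᵇ m)
≡ᵇ-sym zero    zero    = refl
≡ᵇ-sym zero    (suc n) = refl
≡ᵇ-sym (suc m) zero    = refl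
≡ᵇ-sym (suc m) (suc n) = ≡ᵇ-sym m n

≡ᵇ-true⇒≡ : ∀ m n → (m ≡ᵇ n) ≡ true → m ≡ n
≡ᵇ-true⇒≡ m n eq = ≡ᵇ⇒≡ m n (Equivalence.from T-≡ eq)

≡ᵇ-false⇒≢ : ∀ m n → (m ≡ᵇ n) ≡ false → m ≢ n
≡ᵇ-false⇒≢ m _ eq refl with () ← trans (sym eq) (≡ᵇ-refl m)

mult mult≢ : ℕ → List ℕ → ℕ
mult  y = count (y ≡ᵇ_)
mult≢ y = count (not ∘ (y ≡ᵇ_))

mult+mult≢ : ∀ y w → mult y w + mult≢ y w ≡ length w
mult+mult≢ y []      = refl
mult+mult≢ y (z ∷ w) with y ≡ᵇ z
... | true  = cong suc (mult+mult≢ y w)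
... | false = trans (+-suc _ _) (cong suc (mult+mult≢ y w))

multAvoiding : ℕ → List ℕ → ℕ → ℕ
multAvoiding x w y = if x ≡ᵇ y then 0 else mult y w

equalPairsAvoiding : ℕ → List ℕ → ℕ
equalPairsAvoiding x []       = 0
equalPairsAvoiding x (y ∷ ys) = multAvoiding x ys y + equalPairsAvoiding x ys

-- A pair y z extends x to a two-letter triple only if exactly one of y, z equals x, or y = z ≠ x.
twoLetter-∷-pairs≤ : ∀ x w → count (twoLetter ∘ (x ∷_)) (choose 2 w) ≤ mult x w * mult≢ x w + equalPairsAvoiding x w
twoLetter-∷-pairs≤ x []       = z≤n
twoLetter-∷-pairs≤ x (y ∷ ys) rewrite count-choose-2-∷ (twoLetter ∘ (x ∷_)) y ys with x ≡ᵇ y in x≡ᵇy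
... | true  = ≤-trans (+-mono-≤ (count-mono notX ys) (twoLetter-∷-pairs≤ x ys))
                      (≤-reflexive (sym (+-assoc (mult≢ x ys) (mult x ys * mult≢ x ys) (equalPairsAvoiding x ys))))
  where
  notX : ∀ z → twoLetter (x ∷ y ∷ z ∷ []) ≡ true → not (x ≡ᵇ z) ≡ true
  notX z xyz with x ≡ᵇ z in x≡ᵇz
  ... | false = refl
  ... | true with refl ← ≡ᵇ-true⇒≡ x y x≡ᵇy | refl ← ≡ᵇ-true⇒≡ x z x≡ᵇz
    with () ← trans (sym xyz) (twoLetter-constant {x} refl refl)
... | false = ≤-trans (+-mono-≤ (≤-trans (count-mono xOrY ys) (count-∨ (x ≡ᵇ_) (y ≡ᵇ_) ys))
                                (twoLetter-∷-pairs≤ x ys))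
                      (≤-reflexive (rearrange (mult x ys) (mult y ys) (mult≢ x ys) (equalPairsAvoiding x ys)))
  where
  xOrY : ∀ z → twoLetter (x ∷ y ∷ z ∷ []) ≡ true → ((x ≡ᵇ z) ∨ (y ≡ᵇ z)) ≡ true
  xOrY z xyz with x ≡ᵇ z in x≡ᵇz | y ≡ᵇ z in y≡ᵇz
  ... | true  | _     = refl
  ... | false | true  = refl
  ... | false | false with () ← trans (sym xyz)
        (twoLetter-distinct (≡ᵇ-false⇒≢ x y x≡ᵇy) (≡ᵇ-false⇒≢ y z y≡ᵇz) (≡ᵇ-false⇒≢ x z x≡ᵇz))
  rearrange : ∀ e f d b → (e + f) + (e * d + b) ≡ e * suc d + (f + b)
  rearrange = solve-∀

equalCrossPairsAvoiding : ℕ → List ℕ → List ℕ → ℕ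
equalCrossPairsAvoiding x ys w = sum (map (multAvoiding x w) ys)

equalUnequalTriples : List ℕ → List ℕ → ℕ
equalUnequalTriples ys w = sum (map (λ y → mult y w * mult≢ y w) ys)

equalCrossPairsAvoiding-∷₃ : ∀ x ys z w → equalCrossPairsAvoiding x ys (z ∷ w) ≡
                             equalCrossPairsAvoiding x ys w + count (λ y → not (x ≡ᵇ y) ∧ (y ≡ᵇ z)) ys
equalCrossPairsAvoiding-∷₃ x []       z w = refl
equalCrossPairsAvoiding-∷₃ x (y ∷ ys) z w with x ≡ᵇ y
... | true  = equalCrossPairsAvoiding-∷₃ x ys z w
... | false with y ≡ᵇ z
...   | true  = trans (cong (suc (mult y w) +_) (equalCrossPairsAvoiding-∷₃ x ys z w)) (rearrange (mult y w) _ _)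
  where
  rearrange : ∀ a h c → suc a + (h + c) ≡ a + h + suc c
  rearrange = solve-∀
...   | false = trans (cong (mult y w +_) (equalCrossPairsAvoiding-∷₃ x ys z w)) (sym (+-assoc (mult y w) _ _))

2*equalPairsAvoiding≤ : ∀ x w → 2 * equalPairsAvoiding x w ≤ equalCrossPairsAvoiding x w w
2*equalPairsAvoiding≤ x []       = z≤n
2*equalPairsAvoiding≤ x (y ∷ ys) rewrite equalCrossPairsAvoiding-∷₃ x ys y ys with x ≡ᵇ y in x≡ᵇy
... | true  = ≤-trans (2*equalPairsAvoiding≤ x ys) (m≤m+n _ _)
... | false rewrite ≡ᵇ-refl y = combine (2*equalPairsAvoiding≤ x ys) (count-mono sameAsY ys)
  where
  sameAsY : ∀ z → (y ≡ᵇ z) ≡ true → (not (x ≡ᵇ z) ∧ (z ≡ᵇ y)) ≡ true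
  sameAsY z y≡ᵇz with refl ← ≡ᵇ-true⇒≡ y z y≡ᵇz rewrite x≡ᵇy | ≡ᵇ-refl y = refl
  combine : ∀ {a b h c} → 2 * b ≤ h → a ≤ c → 2 * (a + b) ≤ suc a + (h + c)
  combine {a} {b} 2b≤h a≤c = ≤-trans (≤-reflexive (rearrange a b)) (+-mono-≤ (n≤1+n a) (+-mono-≤ 2b≤h a≤c))
    where
    rearrange : ∀ a b → 2 * (a + b) ≡ a + (2 * b + a)
    rearrange = solve-∀

equalUnequalTriples-∷₂ : ∀ ys x w → equalUnequalTriples ys (x ∷ w) ≡
                         equalUnequalTriples ys w + (mult x ys * mult≢ x w + equalCrossPairsAvoiding x ys w)
equalUnequalTriples-∷₂ []       x w = refl
equalUnequalTriples-∷₂ (y ∷ ys) x w rewrite ≡ᵇ-sym y x | equalUnequalTriples-∷₂ ys x w with x ≡ᵇ y in x≡ᵇy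
... | true with refl ← ≡ᵇ-true⇒≡ x y x≡ᵇy =
  rearrange (mult x w) (mult≢ x w) (equalUnequalTriples ys w) (mult x ys) (equalCrossPairsAvoiding x ys w)
  where
  rearrange : ∀ a d g b h → suc a * d + (g + (b * d + h)) ≡ a * d + g + (suc b * d + (0 + h))
  rearrange = solve-∀
... | false =
  rearrange (mult y w) (mult≢ y w) (equalUnequalTriples ys w) (mult x ys) (mult≢ x w) (equalCrossPairsAvoiding x ys w)
  where
  rearrange : ∀ a d g b d′ h → a * suc d + (g + (b * d′ + h)) ≡ a * d + g + (b * d′ + (a + h))
  rearrange = solve-∀

2*twoLetter≤equalUnequalTriples : ∀ w → 2 * occurrences twoLetterPatterns 3 w ≤ equalUnequalTriples w w
2*twoLetter≤equalUnequalTriples []       = z≤n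
2*twoLetter≤equalUnequalTriples (x ∷ xs)
  rewrite count-choose-∷ twoLetter 2 x xs | equalUnequalTriples-∷₂ xs x xs | ≡ᵇ-refl x =
  combine {e = mult x xs} {mult≢ x xs} {equalPairsAvoiding x xs}
          (twoLetter-∷-pairs≤ x xs) (2*equalPairsAvoiding≤ x xs) (2*twoLetter≤equalUnequalTriples xs)
  where
  combine : ∀ {p n e d b h g} → p ≤ e * d + b → 2 * b ≤ h → 2 * n ≤ g → 2 * (p + n) ≤ suc e * d + (g + (e * d + h))
  combine {p} {n} {e} {d} {b} {h} {g} p≤ 2b≤h 2n≤g = begin
    2 * (p + n)                              ≡⟨ *-distribˡ-+ 2 p n ⟩
    2 * p + 2 * n                            ≤⟨ +-mono-≤ (*-monoʳ-≤ 2 p≤) 2n≤g ⟩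
    2 * (e * d + b) + g                      ≡⟨ rearrange e d b g ⟩
    e * d + e * d + (2 * b + g)              ≤⟨ +-monoʳ-≤ (e * d + e * d) (+-monoˡ-≤ g 2b≤h) ⟩
    e * d + e * d + (h + g)                  ≤⟨ m≤n+m _ d ⟩
    d + (e * d + e * d + (h + g))            ≡⟨ rearrange′ e d h g ⟩
    suc e * d + (g + (e * d + h))            ∎
    where
    open ≤-Reasoning
    rearrange : ∀ e d b g → 2 * (e * d + b) + g ≡ e * d + e * d + (2 * b + g)
    rearrange = solve-∀
    rearrange′ : ∀ e d h g → d + (e * d + e * d + (h + g)) ≡ suc e * d + (g + (e * d + h))
    rearrange′ = solve-∀

4mn≤[m+n]² : ∀ m n → 4 * (m * n) ≤ (m + n) * (m + n)
4mn≤[m+n]² m n with ≤-total m n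
... | inj₁ m≤n rewrite sym (m+[n∸m]≡n m≤n) = ≤-trans (m≤m+n _ _) (≤-reflexive (square m (n ∸ m)))
  where
  square : ∀ a c → 4 * (a * (a + c)) + c * c ≡ (a + (a + c)) * (a + (a + c))
  square = solve-∀
... | inj₂ n≤m rewrite sym (m+[n∸m]≡n n≤m) = ≤-trans (m≤m+n _ _) (≤-reflexive (square n (m ∸ n)))
  where
  square : ∀ a c → 4 * ((a + c) * a) + c * c ≡ ((a + c) + a) * ((a + c) + a)
  square = solve-∀

4*equalUnequalTriples≤ : ∀ ys w → 4 * equalUnequalTriples ys w ≤ length ys * (length w * length w)
4*equalUnequalTriples≤ []       w = ≤-reflexive (*-zeroʳ 4)
4*equalUnequalTriples≤ (y ∷ ys) w = begin
  4 * (mult y w * mult≢ y w + equalUnequalTriples ys w)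
    ≡⟨ *-distribˡ-+ 4 (mult y w * mult≢ y w) (equalUnequalTriples ys w) ⟩
  4 * (mult y w * mult≢ y w) + 4 * equalUnequalTriples ys w
    ≤⟨ +-mono-≤ (4mn≤[m+n]² (mult y w) (mult≢ y w)) (4*equalUnequalTriples≤ ys w) ⟩
  (mult y w + mult≢ y w) * (mult y w + mult≢ y w) + length ys * (length w * length w)
    ≡⟨ cong (λ n → n * n + length ys * (length w * length w)) (mult+mult≢ y w) ⟩
  length w * length w + length ys * (length w * length w) ∎
  where open ≤-Reasoning

8*twoLetter≤cube : ∀ w → 8 * occurrences twoLetterPatterns 3 w ≤ length w * (length w * length w)
8*twoLetter≤cube w = begin
  8 * occurrences twoLetterPatterns 3 w       ≡⟨ *-assoc 4 2 (occurrences twoLetterPatterns 3 w) ⟩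
  4 * (2 * occurrences twoLetterPatterns 3 w) ≤⟨ *-monoʳ-≤ 4 (2*twoLetter≤equalUnequalTriples w) ⟩
  4 * equalUnequalTriples w w                 ≤⟨ 4*equalUnequalTriples≤ w w ⟩
  length w * (length w * length w)            ∎
  where open ≤-Reasoning

8*maxν≤cube : {Π : List (List ℕ)} → Π ⊆ twoLetterPatterns → ∀ k n → 8 * maxν Π 3 k n ≤ n * (n * n)
8*maxν≤cube {Π} Π⊆ k n = *-maxν-lub Π 3 8 {k} {n} λ σ → begin
  8 * ν Π 3 σ                                            ≡⟨ cong (8 *_) (ν≡occurrences Π 3 σ) ⟩
  8 * occurrences Π 3 (letters σ)                        ≤⟨ *-monoʳ-≤ 8 (occurrences-mono Π⊆ 3 (letters σ)) ⟩
  8 * occurrences twoLetterPatterns 3 (letters σ)        ≤⟨ 8*twoLetter≤cube (letters σ) ⟩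
  length (letters σ) * (length (letters σ) * length (letters σ)) ≡⟨ cong (λ m → m * (m * m)) (length-letters σ) ⟩
  n * (n * n)                                            ∎
  where open ≤-Reasoning

-- Lower bound
[1+n]C2 : ∀ n → suc n C 2 ≡ n + n C 2
[1+n]C2 n = trans (sym (nCk+nC[k+1]≡[n+1]C[k+1] n 1)) (cong (_+ n C 2) (nC1≡n n))

-- Shifted so that no truncated subtraction appears and the ring solver applies after substitution.
2*[1+n]C2 : ∀ n → 2 * (suc n C 2) ≡ suc n * n
2*[1+n]C2 zero    = refl
2*[1+n]C2 (suc n) = begin
  2 * (suc (suc n) C 2)        ≡⟨ cong (2 *_) ([1+n]C2 (suc n)) ⟩
  2 * (suc n + suc n C 2)      ≡⟨ *-distribˡ-+ 2 (suc n) (suc n C 2) ⟩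
  2 * suc n + 2 * (suc n C 2)  ≡⟨ cong (2 * suc n +_) (2*[1+n]C2 n) ⟩
  2 * suc n + suc n * n        ≡⟨ rearrange n ⟩
  suc (suc n) * suc n          ∎
  where
  open ≡-Reasoning
  rearrange : ∀ n → 2 * suc n + suc n * n ≡ suc (suc n) * suc n
  rearrange = solve-∀

6*[2+n]C3 : ∀ n → 6 * (suc (suc n) C 3) ≡ suc (suc n) * (suc n * n)
6*[2+n]C3 zero    = refl
6*[2+n]C3 (suc n) = begin
  6 * (suc (suc (suc n)) C 3)                        ≡⟨ cong (6 *_) (nCk+nC[k+1]≡[n+1]C[k+1] (suc (suc n)) 2) ⟨
  6 * (suc (suc n) C 2 + suc (suc n) C 3)            ≡⟨ *-distribˡ-+ 6 (suc (suc n) C 2) _ ⟩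
  6 * (suc (suc n) C 2) + 6 * (suc (suc n) C 3)
    ≡⟨ cong₂ _+_ (trans (*-assoc 3 2 (suc (suc n) C 2)) (cong (3 *_) (2*[1+n]C2 (suc n)))) (6*[2+n]C3 n) ⟩
  3 * (suc (suc n) * suc n) + suc (suc n) * (suc n * n) ≡⟨ rearrange n ⟩
  suc (suc (suc n)) * (suc (suc n) * suc n)          ∎
  where
  open ≡-Reasoning
  rearrange : ∀ n → 3 * (suc (suc n) * suc n) + suc (suc n) * (suc n * n) ≡ suc (suc (suc n)) * (suc (suc n) * suc n)
  rearrange = solve-∀

twoBlockCount : ℕ → ℕ → ℕ
twoBlockCount a b = b * (a C 2) + a * (b C 2)

zerosOnes : ℕ → ℕ → List ℕ
zerosOnes a b = replicate a 0 ++ replicate b 1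

rising : List ℕ → Bool
rising = matches risingTwoLetterPatterns

rising-0∷-pairs : ∀ a b → count (rising ∘ (0 ∷_)) (choose 2 (zerosOnes a b)) ≡ a * b + b C 2
rising-0∷-pairs zero    b = trans (cong (count _) (choose-replicate 2 b 1)) (count-replicate-true _ (b C 2) refl)
rising-0∷-pairs (suc a) b = begin
  count (rising ∘ (0 ∷_)) (choose 2 (0 ∷ zerosOnes a b))
    ≡⟨ count-choose-2-∷ (rising ∘ (0 ∷_)) 0 (zerosOnes a b) ⟩
  count (λ z → rising (0 ∷ 0 ∷ z ∷ [])) (zerosOnes a b) + count (rising ∘ (0 ∷_)) (choose 2 (zerosOnes a b))
    ≡⟨ cong₂ _+_ (count-++ _ (replicate a 0) (replicate b 1)) (rising-0∷-pairs a b) ⟩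
  (count (λ z → rising (0 ∷ 0 ∷ z ∷ [])) (replicate a 0) + count (λ z → rising (0 ∷ 0 ∷ z ∷ [])) (replicate b 1))
    + (a * b + b C 2)
    ≡⟨ cong₂ (λ m n → (m + n) + (a * b + b C 2)) (count-replicate-false _ a refl) (count-replicate-true _ b refl) ⟩
  b + (a * b + b C 2)
    ≡⟨ +-assoc b (a * b) (b C 2) ⟨
  suc a * b + b C 2 ∎
  where open ≡-Reasoning

occurrences-zerosOnes : ∀ a b → occurrences risingTwoLetterPatterns 3 (zerosOnes a b) ≡ twoBlockCount a b
occurrences-zerosOnes zero    b = begin
  count rising (choose 3 (replicate b 1))  ≡⟨ cong (count rising) (choose-replicate 3 b 1) ⟩
  count rising (replicate (b C 3) (1 ∷ 1 ∷ 1 ∷ [])) ≡⟨ count-replicate-false rising (b C 3) refl ⟩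
  0                                        ≡⟨ trans (+-identityʳ (b * 0)) (*-zeroʳ b) ⟨
  b * 0 + 0                                ∎
  where open ≡-Reasoning
occurrences-zerosOnes (suc a) b = begin
  occurrences risingTwoLetterPatterns 3 (0 ∷ zerosOnes a b)
    ≡⟨ count-choose-∷ rising 2 0 (zerosOnes a b) ⟩
  count (rising ∘ (0 ∷_)) (choose 2 (zerosOnes a b)) + occurrences risingTwoLetterPatterns 3 (zerosOnes a b)
    ≡⟨ cong₂ _+_ (rising-0∷-pairs a b) (occurrences-zerosOnes a b) ⟩
  (a * b + b C 2) + (b * (a C 2) + a * (b C 2))
    ≡⟨ rearrange a b (a C 2) (b C 2) ⟩
  b * (a + a C 2) + suc a * (b C 2)
    ≡⟨ cong (λ c → b * c + suc a * (b C 2)) ([1+n]C2 a) ⟨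
  b * (suc a C 2) + suc a * (b C 2) ∎
  where
  open ≡-Reasoning
  rearrange : ∀ a b a₂ b₂ → (a * b + b₂) + (b * a₂ + a * b₂) ≡ b * (a + a₂) + suc a * b₂
  rearrange = solve-∀

twoBlock : (a b : ℕ) → Vec (Fin 2) (a + b)
twoBlock zero    b = Vec.replicate b (Fin.suc Fin.zero)
twoBlock (suc a) b = Fin.zero Vec.∷ twoBlock a b

letters-twoBlock : ∀ a b → letters (twoBlock a b) ≡ zerosOnes a b
letters-twoBlock zero    zero    = refl
letters-twoBlock zero    (suc b) = cong (1 ∷_) (letters-twoBlock zero b)
letters-twoBlock (suc a) b       = cong (0 ∷_) (letters-twoBlock a b)

maxν-lower : {Π : List (List ℕ)} → risingTwoLetterPatterns ⊆ Π → ∀ {k} → 2 ≤ k → ∀ a b →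
             twoBlockCount a b ≤ maxν Π 3 k (a + b)
maxν-lower {Π} rising⊆ 2≤k a b = begin
  twoBlockCount a b                                  ≡⟨ occurrences-zerosOnes a b ⟨
  occurrences risingTwoLetterPatterns 3 (zerosOnes a b) ≤⟨ occurrences-mono rising⊆ 3 (zerosOnes a b) ⟩
  occurrences Π 3 (zerosOnes a b)                    ≡⟨ cong (occurrences Π 3) (letters-twoBlock a b) ⟨
  occurrences Π 3 (letters (twoBlock a b))           ≡⟨ ν≡occurrences Π 3 (twoBlock a b) ⟨
  ν Π 3 (twoBlock a b)                               ≡⟨ ν-embed Π 3 2≤k (twoBlock a b) ⟨
  ν Π 3 (embed 2≤k (twoBlock a b))                   ≤⟨ ν≤maxν Π 3 (embed 2≤k (twoBlock a b)) ⟩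
  maxν Π 3 _ (a + b)                                 ∎
  where open ≤-Reasoning

3*C3≤4*twoBlockCount-even : ∀ u → 3 * ((suc u + suc u) C 3) ≤ 4 * twoBlockCount (suc u) (suc u)
3*C3≤4*twoBlockCount-even u = *-cancelˡ-≤ 6 (begin
  6 * (3 * c)                                          ≡⟨ *-comm-3-6 c ⟩
  3 * (6 * c)                                          ≡⟨ cong (3 *_) (6*c) ⟩
  3 * (suc (suc (u + u)) * (suc (u + u) * (u + u)))    ≤⟨ m≤m+n _ _ ⟩
  3 * (suc (suc (u + u)) * (suc (u + u) * (u + u))) + 12 * (u * suc u) ≡⟨ rearrange u ⟩
  24 * (suc u * (suc u * u))                           ≡⟨ cong (λ m → 24 * (suc u * m)) (2*[1+n]C2 u) ⟨
  24 * (suc u * (2 * (suc u C 2)))                     ≡⟨ rearrange′ (suc u) (suc u C 2) ⟩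
  6 * (4 * twoBlockCount (suc u) (suc u))             ∎)
  where
  open ≤-Reasoning
  c = (suc u + suc u) C 3
  6*c : 6 * c ≡ suc (suc (u + u)) * (suc (u + u) * (u + u))
  6*c = trans (cong (λ n → 6 * (n C 3)) (cong suc (+-suc u u))) (6*[2+n]C3 (u + u))
  *-comm-3-6 : ∀ c → 6 * (3 * c) ≡ 3 * (6 * c)
  *-comm-3-6 = solve-∀
  rearrange : ∀ u → 3 * (suc (suc (u + u)) * (suc (u + u) * (u + u))) + 12 * (u * suc u) ≡ 24 * (suc u * (suc u * u))
  rearrange = solve-∀
  rearrange′ : ∀ a c → 24 * (a * (2 * c)) ≡ 6 * (4 * (a * c + a * c))
  rearrange′ = solve-∀

3*C3≤4*twoBlockCount-odd : ∀ u → 3 * ((suc u + suc (suc u)) C 3) ≤ 4 * twoBlockCount (suc u) (suc (suc u))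
3*C3≤4*twoBlockCount-odd u = *-cancelˡ-≤ 6 (begin
  6 * (3 * c)                                          ≡⟨ *-comm-3-6 c ⟩
  3 * (6 * c)                                          ≡⟨ cong (3 *_) (6*c) ⟩
  3 * (suc (suc (suc (u + u))) * (suc (suc (u + u)) * suc (u + u)))   ≤⟨ m≤m+n _ _ ⟩
  3 * (suc (suc (suc (u + u))) * (suc (suc (u + u)) * suc (u + u))) + 6 * (suc u * suc (u + u)) ≡⟨ rearrange u ⟩
  12 * (suc (suc u) * (suc u * u) + suc u * (suc (suc u) * suc u))
    ≡⟨ cong₂ (λ m n → 12 * (suc (suc u) * m + suc u * n)) (2*[1+n]C2 u) (2*[1+n]C2 (suc u)) ⟨
  12 * (suc (suc u) * (2 * (suc u C 2)) + suc u * (2 * (suc (suc u) C 2)))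
    ≡⟨ rearrange′ (suc (suc u)) (suc u) (suc u C 2) (suc (suc u) C 2) ⟩
  6 * (4 * twoBlockCount (suc u) (suc (suc u)))       ∎)
  where
  open ≤-Reasoning
  c = (suc u + suc (suc u)) C 3
  6*c : 6 * c ≡ suc (suc (suc (u + u))) * (suc (suc (u + u)) * suc (u + u))
  6*c = trans (cong (λ n → 6 * (n C 3)) (cong suc (trans (+-suc u (suc u)) (cong suc (+-suc u u))))) (6*[2+n]C3 (suc (u + u)))
  *-comm-3-6 : ∀ c → 6 * (3 * c) ≡ 3 * (6 * c)
  *-comm-3-6 = solve-∀
  rearrange : ∀ u → 3 * (suc (suc (suc (u + u))) * (suc (suc (u + u)) * suc (u + u))) + 6 * (suc u * suc (u + u)) ≡
                    12 * (suc (suc u) * (suc u * u) + suc u * (suc (suc u) * suc u))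
  rearrange = solve-∀
  rearrange′ : ∀ a b s t → 12 * (a * (2 * s) + b * (2 * t)) ≡ 6 * (4 * (a * s + b * t))
  rearrange′ = solve-∀

3*C3≤4*twoBlockCount : ∀ a b → b ≡ a ⊎ b ≡ suc a → 3 * ((a + b) C 3) ≤ 4 * twoBlockCount a b
3*C3≤4*twoBlockCount zero    _ (inj₁ refl) = z≤n
3*C3≤4*twoBlockCount zero    _ (inj₂ refl) = z≤n
3*C3≤4*twoBlockCount (suc u) _ (inj₁ refl) = 3*C3≤4*twoBlockCount-even u
3*C3≤4*twoBlockCount (suc u) _ (inj₂ refl) = 3*C3≤4*twoBlockCount-odd u

⌈n/2⌉≡⌊n/2⌋⊎1+⌊n/2⌋ : ∀ n → ⌈ n /2⌉ ≡ ⌊ n /2⌋ ⊎ ⌈ n /2⌉ ≡ suc ⌊ n /2⌋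
⌈n/2⌉≡⌊n/2⌋⊎1+⌊n/2⌋ zero          = inj₁ refl
⌈n/2⌉≡⌊n/2⌋⊎1+⌊n/2⌋ (suc zero)    = inj₂ refl
⌈n/2⌉≡⌊n/2⌋⊎1+⌊n/2⌋ (suc (suc n)) = Sum.map (cong suc) (cong suc) (⌈n/2⌉≡⌊n/2⌋⊎1+⌊n/2⌋ n)

3*C3≤4*maxν : {Π : List (List ℕ)} → risingTwoLetterPatterns ⊆ Π → ∀ {k} → 2 ≤ k → ∀ n →
              3 * (n C 3) ≤ 4 * maxν Π 3 k n
3*C3≤4*maxν {Π} rising⊆ {k} 2≤k n = subst (λ m → 3 * (m C 3) ≤ 4 * maxν Π 3 k m) (⌊n/2⌋+⌈n/2⌉≡n n)
  (≤-trans (3*C3≤4*twoBlockCount ⌊ n /2⌋ ⌈ n /2⌉ (⌈n/2⌉≡⌊n/2⌋⊎1+⌊n/2⌋ n))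
           (*-monoʳ-≤ 4 (maxν-lower rising⊆ 2≤k ⌊ n /2⌋ ⌈ n /2⌉)))

-- Convergence
-- With n = 3 + t, c = C(n,3) and X the maximal number of occurrences, D = 4X − 3c and
-- |X/c − 3/4| = D/(4c).
module _ (t c X D : ℕ) (6c≡ : 6 * c ≡ (3 + t) * ((2 + t) * (1 + t))) (8X≤ : 8 * X ≤ (3 + t) * ((3 + t) * (3 + t)))
         (X*4≡ : X * 4 ≡ 3 * c + D) where

  2*excess≤ : 2 * D ≤ 3 * ((3 + t) * (3 + t))
  2*excess≤ = +-cancelˡ-≤ (6 * c) _ _ (begin
    6 * c + 2 * D                                      ≡⟨ distrib c D ⟩
    2 * (3 * c + D)                                    ≡⟨ cong (2 *_) X*4≡ ⟨
    2 * (X * 4)                                        ≡⟨ *-comm-2-4 X ⟩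
    8 * X                                              ≤⟨ 8X≤ ⟩
    (3 + t) * ((3 + t) * (3 + t))                      ≤⟨ m≤m+n _ (2 * (3 + t)) ⟩
    (3 + t) * ((3 + t) * (3 + t)) + 2 * (3 + t)        ≡⟨ cube t ⟩
    (3 + t) * ((2 + t) * (1 + t)) + 3 * ((3 + t) * (3 + t)) ≡⟨ cong (_+ 3 * ((3 + t) * (3 + t))) 6c≡ ⟨
    6 * c + 3 * ((3 + t) * (3 + t))                    ∎)
    where
    open ≤-Reasoning
    distrib : ∀ c D → 6 * c + 2 * D ≡ 2 * (3 * c + D)
    distrib = solve-∀
    *-comm-2-4 : ∀ X → 2 * (X * 4) ≡ 8 * X
    *-comm-2-4 = solve-∀
    cube : ∀ t → (3 + t) * ((3 + t) * (3 + t)) + 2 * (3 + t) ≡ (3 + t) * ((2 + t) * (1 + t)) + 3 * ((3 + t) * (3 + t))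
    cube = solve-∀

  excess*E<c*4 : ∀ E → 3 * E ≤ t → D * E < c * 4
  excess*E<c*4 E 3E≤t = *-cancelˡ-< 6 (D * E) (c * 4) (begin-strict
    6 * (D * E)                              ≡⟨ regroup D E ⟩
    3 * E * (2 * D)                          ≤⟨ *-monoʳ-≤ (3 * E) 2*excess≤ ⟩
    3 * E * (3 * ((3 + t) * (3 + t)))        ≡⟨ regroup′ E t ⟩
    9 * E * (3 + t) * (3 + t)                <⟨ *-monoˡ-< (3 + t) linear ⟩
    4 * ((2 + t) * (1 + t)) * (3 + t)        ≡⟨ regroup″ t ⟩
    4 * ((3 + t) * ((2 + t) * (1 + t)))      ≡⟨ cong (4 *_) 6c≡ ⟨
    4 * (6 * c)                              ≡⟨ *-comm-4-6 c ⟩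
    6 * (c * 4)                              ∎)
    where
    open ≤-Reasoning
    linear : 9 * E * (3 + t) < 4 * ((2 + t) * (1 + t))
    linear = begin-strict
      9 * E * (3 + t)              ≡⟨ cong (_* (3 + t)) (*-assoc 3 3 E) ⟩
      3 * (3 * E) * (3 + t)        ≤⟨ *-monoˡ-≤ (3 + t) (*-monoʳ-≤ 3 3E≤t) ⟩
      3 * t * (3 + t)              <⟨ s≤s (m≤m+n _ _) ⟩
      suc (3 * t * (3 + t) + (t * t + 3 * t + 7)) ≡⟨ square t ⟩
      4 * ((2 + t) * (1 + t))      ∎
      where
      square : ∀ t → suc (3 * t * (3 + t) + (t * t + 3 * t + 7)) ≡ 4 * ((2 + t) * (1 + t))
      square = solve-∀
    regroup : ∀ D E → 6 * (D * E) ≡ 3 * E * (2 * D)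
    regroup = solve-∀
    regroup′ : ∀ E t → 3 * E * (3 * ((3 + t) * (3 + t))) ≡ 9 * E * (3 + t) * (3 + t)
    regroup′ = solve-∀
    regroup″ : ∀ t → 4 * ((2 + t) * (1 + t)) * (3 + t) ≡ 4 * ((3 + t) * ((2 + t) * (1 + t)))
    regroup″ = solve-∀
    *-comm-4-6 : ∀ c → 4 * (6 * c) ≡ 6 * (c * 4)
    *-comm-4-6 = solve-∀

module _ (x y a b D : ℕ) (x*b≡a*y+D : x * suc b ≡ a * suc y + D) where

  private
    numerator : ℤ.+ x ℤ.* ℤ.+ suc b ℤ.+ (ℤ.- ℤ.+ a) ℤ.* ℤ.+ suc y ≡ ℤ.+ D
    numerator = begin
      ℤ.+ x ℤ.* ℤ.+ suc b ℤ.+ (ℤ.- ℤ.+ a) ℤ.* ℤ.+ suc y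
        ≡⟨ cong (ℤ._+ (ℤ.- ℤ.+ a) ℤ.* ℤ.+ suc y) (trans (sym (ℤ.pos-* x (suc b))) (cong ℤ.+_ x*b≡a*y+D)) ⟩
      ℤ.+ (a * suc y + D) ℤ.+ (ℤ.- ℤ.+ a) ℤ.* ℤ.+ suc y
        ≡⟨ cong (ℤ._+ (ℤ.- ℤ.+ a) ℤ.* ℤ.+ suc y)
                (trans (ℤ.pos-+ (a * suc y) D) (cong (ℤ._+ ℤ.+ D) (ℤ.pos-* a (suc y)))) ⟩
      ℤ.+ a ℤ.* ℤ.+ suc y ℤ.+ ℤ.+ D ℤ.+ (ℤ.- ℤ.+ a) ℤ.* ℤ.+ suc y
        ≡⟨ cancel (ℤ.+ a) (ℤ.+ suc y) (ℤ.+ D) ⟩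
      ℤ.+ D ∎
      where
      open ≡-Reasoning
      cancel : ∀ v w d → v ℤ.* w ℤ.+ d ℤ.+ (ℤ.- v) ℤ.* w ≡ d
      cancel = ℤSolver.solve-∀

    -- ℚᵘ stores denominator − 1, and (1 + y)(1 + b) − 1 = b + y(1 + b).
    distanceᵘ : ℚᵘ.∣ mkℚᵘ (ℤ.+ x) y ℚᵘ.- mkℚᵘ (ℤ.+ a) b ∣ ≡ mkℚᵘ (ℤ.+ D) (b + y * suc b)
    distanceᵘ = cong (λ n → ℚᵘ.∣ mkℚᵘ n (b + y * suc b) ∣) numerator

  ∣x/y-a/b∣< : ∀ p e .{cop : Coprime (suc p) (suc e)} → D * suc e < suc p * (suc y * suc b) →
                ℚ.∣ (ℤ.+ x) / suc y ℚ.- (ℤ.+ a) / suc b ∣ ℚ.< mkℚ (ℤ.+ suc p) e cop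
  ∣x/y-a/b∣< p e D*e<p*y*b = ℚ.toℚᵘ-cancel-< (ℚᵘ.<-respˡ-≃ (ℚᵘ.≃-sym toℚᵘ-distance)
    (subst (ℚᵘ._< mkℚᵘ (ℤ.+ suc p) e) (sym distanceᵘ)
      (ℚᵘ.*<* (subst₂ ℤ._<_ (ℤ.pos-* D (suc e)) (ℤ.pos-* (suc p) (suc y * suc b)) (ℤ.+<+ D*e<p*y*b)))))
    where
    toℚᵘ-distance : ℚ.toℚᵘ (ℚ.∣ (ℤ.+ x) / suc y ℚ.- (ℤ.+ a) / suc b ∣) ℚᵘ.≃
                    ℚᵘ.∣ mkℚᵘ (ℤ.+ x) y ℚᵘ.- mkℚᵘ (ℤ.+ a) b ∣
    toℚᵘ-distance =
      ℚᵘ.≃-trans (ℚ.toℚᵘ-homo-∣-∣ (x/y ℚ.- a/b)) (ℚᵘ.∣-∣-cong (ℚᵘ.≃-trans (ℚ.toℚᵘ-homo-+ x/y (ℚ.- a/b))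
        (ℚᵘ.+-cong (ℚ.toℚᵘ-fromℚᵘ (mkℚᵘ (ℤ.+ x) y))
                   (ℚᵘ.≃-trans (ℚ.toℚᵘ-homo‿- a/b) (ℚᵘ.-‿cong (ℚ.toℚᵘ-fromℚᵘ (mkℚᵘ (ℤ.+ a) b)))))))
      where
      x/y a/b : ℚ
      x/y = (ℤ.+ x) / suc y
      a/b = (ℤ.+ a) / suc b

δ≡/ : (Π : List (List ℕ)) (M k n d : ℕ) → n C M ≡ suc d → δ Π M k n ≡ (ℤ.+ maxν Π M k n) / suc d
δ≡/ Π M k n d eq with n C M | eq
... | .(suc d) | refl = refl

6*c≡suc⇒c≡suc : ∀ c {m} → 6 * c ≡ suc m → ∃ λ d → c ≡ suc d
6*c≡suc⇒c≡suc (suc d) _ = d , refl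

module _ {Π : List (List ℕ)} (rising⊆Π : risingTwoLetterPatterns ⊆ Π) (Π⊆twoLetter : Π ⊆ twoLetterPatterns) where

  δ-near-3/4 : ∀ p e .{cop : Coprime (suc p) (suc e)} t → 3 * suc e ≤ t →
               ℚ.∣ δ Π 3 (4 + t) (3 + t) ℚ.- threeQuarters ∣ ℚ.< mkℚ (ℤ.+ suc p) e cop
  δ-near-3/4 p e t 3e≤t =
    subst (λ r → ℚ.∣ r ℚ.- threeQuarters ∣ ℚ.< _) (sym (δ≡/ Π 3 (4 + t) (3 + t) d c≡1+d))
      (∣x/y-a/b∣< X d 3 3 D (subst (λ c → X * 4 ≡ 3 * c + D) c≡1+d X*4≡3c+D) p e
        (≤-trans (subst (λ c → D * suc e < c * 4) c≡1+d excess*e<c*4) (m≤m+n (suc d * 4) (p * (suc d * 4)))))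
    where
    c X D : ℕ
    c = (3 + t) C 3
    X = maxν Π 3 (4 + t) (3 + t)
    D = X * 4 ∸ 3 * c
    6c≡ : 6 * c ≡ (3 + t) * ((2 + t) * (1 + t))
    6c≡ = 6*[2+n]C3 (suc t)
    d : ℕ
    d = proj₁ (6*c≡suc⇒c≡suc c 6c≡)
    c≡1+d : c ≡ suc d
    c≡1+d = proj₂ (6*c≡suc⇒c≡suc c 6c≡)
    X*4≡3c+D : X * 4 ≡ 3 * c + D
    X*4≡3c+D =
      sym (m+[n∸m]≡n (≤-trans (3*C3≤4*maxν rising⊆Π (s≤s (s≤s z≤n)) (3 + t)) (≤-reflexive (*-comm 4 X))))
    excess*e<c*4 : D * suc e < c * 4
    excess*e<c*4 = excess*E<c*4 t c X D 6c≡ (8*maxν≤cube Π⊆twoLetter (4 + t) (3 + t)) X*4≡3c+D (suc e) 3e≤t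

  δ-convergesTo-3/4 : ConvergesTo (λ n → δ Π 3 (suc n) n) threeQuarters
  δ-convergesTo-3/4 (mkℚ (ℤ.+ zero)   _ _) (ℚ.*<* (ℤ.+<+ ()))
  δ-convergesTo-3/4 (mkℚ ℤ.-[1+ _ ]   _ _) (ℚ.*<* ())
  δ-convergesTo-3/4 (mkℚ (ℤ.+ suc p) e _) _ = 3 + 3 * suc e , λ m N≤m →
    subst (λ n → ℚ.∣ δ Π 3 (suc n) n ℚ.- threeQuarters ∣ ℚ.< _) (m+[n∸m]≡n (≤-trans (m≤m+n 3 _) N≤m))
      (δ-near-3/4 p e (m ∸ 3) (∸-monoˡ-≤ 3 N≤m))

  packingDensity-3/4 : PackingDensity Π 3 threeQuarters
  packingDensity-3/4 = (λ n → δ Π 3 (suc n) n) , δ-convergesTo-in-k Π , δ-convergesTo-3/4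

corollary3p4 : PackingDensity (p112 ∷ p121 ∷ p211 ∷ p221 ∷ p212 ∷ p122 ∷ []) 3 threeQuarters
               × PackingDensity (p112 ∷ p122 ∷ []) 3 threeQuarters
corollary3p4 = packingDensity-3/4 rising⊆twoLetter ⊆-refl , packingDensity-3/4 ⊆-refl rising⊆twoLetter
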